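{- There is a $1$-PDDS$[Q_3]$ in $\Lambda_3$, where $Q_3=P_2\square P_2\square P_2$ is the $3$-dimensional hypercube.
   Context: $\Lambda_3$ is the infinite graph with vertex set $\mathbb{Z}^3$ in which two vertices are adjacent iff their Euclidean distance is $1$; $d$ denotes graph distance. For $S$ a set of vertices, $[S]$ is the induced subgraph and $d(v,C)=\min\{d(v,w):w\in C\}$. For $t\ge1$, $S$ is a $t$-perfect distance-dominating set ($t$-PDDS) if for each vertex $v$ there is a unique component $C_v$ of $[S]$ with $d(v,C_v)\le t$, and there is in $C_v$ a unique vertex $w$ with $d(v,w)=d(v,C_v)$. A $t$-PDDS$[H]$ is a $t$-PDDS all of whose components are isomorphic to the fixed finite graph $H$. $P_2$ is the path on $2$ vertices and $\square$ is the Cartesian product of graphs. -}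

module Defs where

open import Level using (0ℓ)
open import Data.Nat using (ℕ; zero; suc; _≤_)
open import Data.Integer using (ℤ; _-_; _*_; _+_) renaming (+_ to ⁺_)
open import Data.Bool using (Bool)
open import Data.Product using (Σ; ∃; _×_; _,_)
open import Data.Sum using (_⊎_)
open import Relation.Nullary using (¬_)
open import Relation.Binary.PropositionalEquality using (_≡_)
open import Relation.Unary using (Pred)
open import Function.Definitions using (Injective)
open import Function.Bundles using (_⇔_)

record Graph : Set₁ where
  field
    V   : Set
    Adj : V → V → Set
open Graph public

P₂ : Graph
P₂ = record { V = Bool ; Adj = λ x y → ¬ (x ≡ y) }

_□_ : Graph → Graph → Graph
G □ H = record
  { V   = V G × V H
  ; Adj = λ { (g , h) (g' , h') → (Adj G g g' × h ≡ h') ⊎ (g ≡ g' × Adj H h h') }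
  }
infixr 6 _□_

Q₃ : Graph
Q₃ = P₂ □ P₂ □ P₂

ℤ³ : Set
ℤ³ = ℤ × ℤ × ℤ

sq : ℤ → ℤ
sq x = x * x

Λ₃ : Graph
Λ₃ = record
  { V   = ℤ³
  ; Adj = λ { (a , b , c) (a' , b' , c') →
              sq (a - a') + sq (b - b') + sq (c - c') ≡ ⁺ 1 }
  }

-- Walks in Λ₃ of a given length whose vertices all satisfy P.
-- (P = everything: walks in Λ₃; P = S: walks in the induced subgraph [S].)
data WalkIn (P : Pred ℤ³ 0ℓ) : ℤ³ → ℤ³ → ℕ → Set where
  here : ∀ {v} → P v → WalkIn P v v zero
  step : ∀ {u v w n} → P u → Adj Λ₃ u v → WalkIn P v w n → WalkIn P u w (suc n)

Everything : Pred ℤ³ 0ℓ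
Everything _ = ⊤' where open import Data.Unit using () renaming (⊤ to ⊤')

DistLe : ℤ³ → ℤ³ → ℕ → Set
DistLe v w k = ∃ λ n → n ≤ k × WalkIn Everything v w n

Conn : Pred ℤ³ 0ℓ → ℤ³ → ℤ³ → Set
Conn S x y = ∃ λ n → WalkIn S x y n

-- w is a vertex of the component of [S] containing s with d(v,w) = d(v,C),
-- i.e. d(v,w) ≤ d(v,w') for every w' in that component.
Closest : Pred ℤ³ 0ℓ → ℤ³ → ℤ³ → ℤ³ → Set
Closest S s v w = Conn S s w × (∀ w' k → Conn S s w' → DistLe v w' k → DistLe v w k)

-- For each v: there is a component C_v (the component of s) with d(v,C_v) ≤ t,
-- every component within distance t of v equals C_v, and there is a unique
-- vertex w of C_v with d(v,w) = d(v,C_v).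
IsPDDS : ℕ → Pred ℤ³ 0ℓ → Set
IsPDDS t S = ∀ v → Σ ℤ³ λ s →
    S s
  × DistLe v s t
  × (∀ s' → S s' → DistLe v s' t → Conn S s s')
  × Σ ℤ³ (λ w → Closest S s v w × (∀ w' → Closest S s v w' → w' ≡ w))

-- Every component of [S] is isomorphic to H (via a bijection onto the
-- component preserving and reflecting adjacency; edges of [S] are the
-- Λ₃-edges between vertices of S).
ComponentsIso : Graph → Pred ℤ³ 0ℓ → Set
ComponentsIso H S = ∀ s → S s → Σ (V H → ℤ³) λ f →
    Injective _≡_ _≡_ f
  × (∀ x → Conn S s (f x))
  × (∀ y → Conn S s y → ∃ λ x → f x ≡ y)
  × (∀ x y → Adj H x y ⇔ Adj Λ₃ (f x) (f y))

IsPDDS[_] : Graph → ℕ → Pred ℤ³ 0ℓ → Set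
IsPDDS[ H ] t S = IsPDDS t S × ComponentsIso H S

-- Write each coordinate modulo 4 in binary, as (high bit , low bit), and let S be the set of
-- points whose three high bits agree, i.e. v mod 4 ∈ {0,1}³ ∪ {2,3}³. The components of [S] are
-- the unit cubes with lowest corner in 4ℤ³ ∪ (4ℤ³ + (2,2,2)), copies of Q₃. A unit step changes
-- the high bit of the moved coordinate only when it carries (upwards from low bit 1, downwards
-- from low bit 0), so along each axis exactly one of the two directions does. A point outside S
-- has two equal high bits and one odd one out, and its only neighbour in S is reached by the step
-- that flips the odd one. Hence S is a perfect dominating set, and perfect dominating sets are
-- 1-PDDSs.
module Submission where

open import Defs
open import Level using (0ℓ)
open import Data.Bool using (Bool; true; false; not)
open import Data.Bool.Properties using (not-involutive; not-¬) renaming (_≟_ to _≟ᵇ_)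
open import Data.Empty using (⊥-elim)
open import Data.Integer using (ℤ; +_; -[1+_]; _+_; _-_; -_; ∣_∣)
import Data.Integer.Properties as ℤᵖ
open import Algebra.Properties.AbelianGroup ℤᵖ.+-0-abelianGroup using (∙-cancelˡ)
open import Data.Integer.Tactic.RingSolver using (solve-∀)
open import Data.Nat using (zero; suc; _≤_; z≤n; s≤s) renaming (_+_ to _+ℕ_; _*_ to _*ℕ_)
open import Data.Nat.Properties using (≤-refl; ≤-trans; +-comm; +-identityʳ)
open import Data.Product using (Σ; ∃; ∃₂; _×_; _,_; proj₁; proj₂)
open import Data.Sum using (_⊎_; inj₁; inj₂)
open import Data.Unit using (tt)
open import Function.Base using (_∘_)
open import Function.Bundles using (_⇔_; mk⇔; Equivalence)
open import Function.Definitions using (Injective)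
open import Relation.Binary.PropositionalEquality using (_≡_; refl; sym; trans; cong; cong₂; subst)
open import Relation.Nullary using (¬_; Dec; yes; no)
open import Relation.Nullary.Decidable using (_×-dec_)
open import Relation.Unary using (Pred)

data Axis : Set where
  X Y Z : Axis

data Sign : Set where
  up down : Sign

unit : Sign → ℤ
unit up   = + 1
unit down = -[1+ 0 ]

move : Axis → Sign → ℤ³ → ℤ³
move X e (a , b , c) = a + unit e , b , c
move Y e (a , b , c) = a , b + unit e , c
move Z e (a , b , c) = a , b , c + unit e

coord : Axis → ℤ³ → ℤ
coord X (a , _ , _) = a
coord Y (_ , b , _) = b
coord Z (_ , _ , c) = c

_⊞_ : ℤ³ → ℤ³ → ℤ³
(a , b , c) ⊞ (a' , b' , c') = a + a' , b + b' , c + c'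

sq-unit : ∀ e → sq (- unit e) ≡ + 1
sq-unit up   = refl
sq-unit down = refl

sq-∣∣ : ∀ p → sq p ≡ + (∣ p ∣ *ℕ ∣ p ∣)
sq-∣∣ (+ zero)  = refl
sq-∣∣ (+ suc n) = refl
sq-∣∣ -[1+ n ]  = refl

a-[a+k] : ∀ a k → a - (a + k) ≡ - k
a-[a+k] = solve-∀

adj-move : ∀ i e v → Adj Λ₃ v (move i e v)
adj-move X e (a , b , c) rewrite a-[a+k] a (unit e) | ℤᵖ.+-inverseʳ b | ℤᵖ.+-inverseʳ c | sq-unit e = refl
adj-move Y e (a , b , c) rewrite a-[a+k] b (unit e) | ℤᵖ.+-inverseʳ a | ℤᵖ.+-inverseʳ c | sq-unit e = refl
adj-move Z e (a , b , c) rewrite a-[a+k] c (unit e) | ℤᵖ.+-inverseʳ a | ℤᵖ.+-inverseʳ b | sq-unit e = refl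

squares≡1 : ∀ m n k → m *ℕ m +ℕ n *ℕ n +ℕ k *ℕ k ≡ 1 →
            (m ≡ 1 × n ≡ 0 × k ≡ 0) ⊎ (m ≡ 0 × n ≡ 1 × k ≡ 0) ⊎ (m ≡ 0 × n ≡ 0 × k ≡ 1)
squares≡1 0 0 0 ()
squares≡1 0 0 1 _ = inj₂ (inj₂ (refl , refl , refl))
squares≡1 0 0 (suc (suc _)) ()
squares≡1 0 1 0 _ = inj₂ (inj₁ (refl , refl , refl))
squares≡1 0 1 (suc _) ()
squares≡1 0 (suc (suc _)) _ ()
squares≡1 1 0 0 _ = inj₁ (refl , refl , refl)
squares≡1 1 0 (suc _) ()
squares≡1 1 (suc _) _ ()
squares≡1 (suc (suc _)) _ _ ()

∣-∣≡0 : ∀ a a' → ∣ a - a' ∣ ≡ 0 → a' ≡ a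
∣-∣≡0 a a' d = sym (ℤᵖ.i-j≡0⇒i≡j a a' (ℤᵖ.∣i∣≡0⇒i≡0 d))

neg-unit : ∀ p → ∣ p ∣ ≡ 1 → ∃ λ e → - p ≡ unit e
neg-unit (+ 1)           _  = down , refl
neg-unit -[1+ 0 ]        _  = up , refl
neg-unit (+ 0)           ()
neg-unit (+ suc (suc _)) ()
neg-unit -[1+ suc _ ]    ()

∣-∣≡1 : ∀ a a' → ∣ a - a' ∣ ≡ 1 → ∃ λ e → a' ≡ a + unit e
∣-∣≡1 a a' d with neg-unit (a - a') d
... | e , eq = e , trans (a'≡a-[a-a'] a a') (cong (_+_ a) eq)
  where
    a'≡a-[a-a'] : ∀ a a' → a' ≡ a + - (a - a')
    a'≡a-[a-a'] = solve-∀

adj⇒move : ∀ v w → Adj Λ₃ v w → ∃₂ λ i e → w ≡ move i e v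
adj⇒move (a , b , c) (a' , b' , c') adj with squares≡1 _ _ _ squares
  where
    squares : ∣ a - a' ∣ *ℕ ∣ a - a' ∣ +ℕ ∣ b - b' ∣ *ℕ ∣ b - b' ∣ +ℕ ∣ c - c' ∣ *ℕ ∣ c - c' ∣ ≡ 1
    squares = ℤᵖ.+-injective (trans (sym (cong₂ _+_ (cong₂ _+_ (sq-∣∣ (a - a')) (sq-∣∣ (b - b')))
                                                   (sq-∣∣ (c - c')))) adj)
... | inj₁ (da , db , dc)
  with ∣-∣≡1 a a' da | ∣-∣≡0 b b' db | ∣-∣≡0 c c' dc
...  | e , refl | refl | refl = X , e , refl
adj⇒move (a , b , c) (a' , b' , c') adj | inj₂ (inj₁ (da , db , dc))
  with ∣-∣≡0 a a' da | ∣-∣≡1 b b' db | ∣-∣≡0 c c' dc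
...  | refl | e , refl | refl = Y , e , refl
adj⇒move (a , b , c) (a' , b' , c') adj | inj₂ (inj₂ (da , db , dc))
  with ∣-∣≡0 a a' da | ∣-∣≡0 b b' db | ∣-∣≡1 c c' dc
...  | refl | refl | e , refl = Z , e , refl

adj-translate : ∀ A v w → Adj Λ₃ (A ⊞ v) (A ⊞ w) ≡ Adj Λ₃ v w
adj-translate (a , b , c) (p , q , r) (p' , q' , r') =
  cong (_≡ + 1) (cong₂ _+_ (cong₂ _+_ (cong sq (shift a p p')) (cong sq (shift b q q')))
                           (cong sq (shift c r r')))
  where
    shift : ∀ a p q → (a + p) - (a + q) ≡ p - q
    shift = solve-∀

_++ʷ_ : ∀ {P u v w m n} → WalkIn P u v m → WalkIn P v w n → WalkIn P u w (m +ℕ n)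
here _       ++ʷ q = q
step p a w′ ++ʷ q = step p a (w′ ++ʷ q)

walk-start : ∀ {P u v n} → WalkIn P u v n → P u
walk-start (here p)     = p
walk-start (step p _ _) = p

walk-end : ∀ {P u v n} → WalkIn P u v n → P v
walk-end (here p)     = p
walk-end (step _ _ w) = walk-end w

module _ {S : Pred ℤ³ 0ℓ} where

  Conn-refl : ∀ {v} → S v → Conn S v v
  Conn-refl Sv = 0 , here Sv

  Conn-edge : ∀ {u v} → S u → S v → Adj Λ₃ u v → Conn S u v
  Conn-edge Su Sv adj = 1 , step Su adj (here Sv)

  Conn-trans : ∀ {u v w} → Conn S u v → Conn S v w → Conn S u w
  Conn-trans (_ , p) (_ , q) = _ , p ++ʷ q

DistLe-refl : ∀ {v k} → DistLe v v k
DistLe-refl = 0 , z≤n , here tt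

adj⇒DistLe : ∀ {v w} → Adj Λ₃ v w → DistLe v w 1
adj⇒DistLe adj = 1 , ≤-refl , step tt adj (here tt)

DistLe-0 : ∀ {v w} → DistLe v w 0 → v ≡ w
DistLe-0 (zero , _ , here _) = refl

DistLe-1 : ∀ {v w} → DistLe v w 1 → v ≡ w ⊎ Adj Λ₃ v w
DistLe-1 (zero , _ , here _)                  = inj₁ refl
DistLe-1 (suc zero , _ , step _ adj (here _)) = inj₂ adj
DistLe-1 (suc (suc _) , s≤s () , _)

UniqueNeighbour : Pred ℤ³ 0ℓ → ℤ³ → ℤ³ → Set
UniqueNeighbour S v w = S w × Adj Λ₃ v w × (∀ w' → S w' → Adj Λ₃ v w' → w' ≡ w)

PerfectDominating : Pred ℤ³ 0ℓ → Set
PerfectDominating S = ∀ v → S v ⊎ (¬ S v × ∃ (UniqueNeighbour S v))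

perfectDominating⇒PDDS : ∀ {S} → PerfectDominating S → IsPDDS 1 S
perfectDominating⇒PDDS {S} perfect v with perfect v
... | inj₁ Sv = v , Sv , DistLe-refl , near , v , closest , closest-unique
  where
    near : ∀ s' → S s' → DistLe v s' 1 → Conn S v s'
    near s' Ss' d with DistLe-1 d
    ... | inj₁ refl = Conn-refl Sv
    ... | inj₂ adj  = Conn-edge Sv Ss' adj
    closest : Closest S v v v
    closest = Conn-refl Sv , λ _ _ _ _ → DistLe-refl
    closest-unique : ∀ w' → Closest S v v w' → w' ≡ v
    closest-unique w' (_ , nearest) = sym (DistLe-0 (nearest v 0 (Conn-refl Sv) DistLe-refl))
... | inj₂ (∉S , w , Sw , adj , unique) = w , Sw , adj⇒DistLe adj , near , w , closest , closest-unique
  where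
    within-1 : ∀ s' → S s' → DistLe v s' 1 → s' ≡ w
    within-1 s' Ss' d with DistLe-1 d
    ... | inj₁ refl = ⊥-elim (∉S Ss')
    ... | inj₂ adj' = unique s' Ss' adj'
    near : ∀ s' → S s' → DistLe v s' 1 → Conn S w s'
    near s' Ss' d rewrite within-1 s' Ss' d = Conn-refl Sw
    positive : ∀ {s' k} → S s' → DistLe v s' k → 1 ≤ k
    positive Ss' (zero , _ , here _) = ⊥-elim (∉S Ss')
    positive _   (suc _ , n≤k , _)   = ≤-trans (s≤s z≤n) n≤k
    closest : Closest S w v w
    closest = Conn-refl Sw ,
              λ _ _ conn d → 1 , positive (walk-end (proj₂ conn)) d , step tt adj (here tt)
    closest-unique : ∀ w' → Closest S w v w' → w' ≡ w
    closest-unique w' (conn , nearest) =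
      within-1 w' (walk-end (proj₂ conn)) (nearest w 1 (Conn-refl Sw) (adj⇒DistLe adj))

B³ : Set
B³ = Bool × Bool × Bool

[_] : Bool → ℤ
[ false ] = + 0
[ true ]  = + 1

β : B³ → ℤ³
β (p , q , r) = [ p ] , [ q ] , [ r ]

cube : ℤ³ → B³ → ℤ³
cube A x = A ⊞ β x

[]-injective : ∀ {p q} → [ p ] ≡ [ q ] → p ≡ q
[]-injective {false} {false} _ = refl
[]-injective {true}  {true}  _ = refl
[]-injective {false} {true}  ()
[]-injective {true}  {false} ()

bit-flip : ∀ {p q} → ¬ p ≡ q → ∃ λ e → [ q ] ≡ [ p ] + unit e
bit-flip {false} {true}  _  = up , refl
bit-flip {true}  {false} _  = down , refl
bit-flip {false} {false} ne = ⊥-elim (ne refl)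
bit-flip {true}  {true}  ne = ⊥-elim (ne refl)

unit-moves-bit : ∀ p e → ¬ [ p ] ≡ [ p ] + unit e
unit-moves-bit false up   ()
unit-moves-bit false down ()
unit-moves-bit true  up   ()
unit-moves-bit true  down ()

β-adjacency : ∀ x y → Adj Q₃ x y ⇔ Adj Λ₃ (β x) (β y)
β-adjacency x y = mk⇔ (to x y) (from x y)
  where
    to : ∀ x y → Adj Q₃ x y → Adj Λ₃ (β x) (β y)
    to (p , q , r) (p' , _ , _) (inj₁ (p≢p' , refl)) with bit-flip p≢p'
    ... | e , eq = subst (Adj Λ₃ (β (p , q , r))) (cong (_, [ q ] , [ r ]) (sym eq))
                         (adj-move X e (β (p , q , r)))
    to (p , q , r) (_ , q' , _) (inj₂ (refl , inj₁ (q≢q' , refl))) with bit-flip q≢q'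
    ... | e , eq = subst (Adj Λ₃ (β (p , q , r))) (cong (λ t → [ p ] , t , [ r ]) (sym eq))
                         (adj-move Y e (β (p , q , r)))
    to (p , q , r) (_ , _ , r') (inj₂ (refl , inj₂ (refl , r≢r'))) with bit-flip r≢r'
    ... | e , eq = subst (Adj Λ₃ (β (p , q , r))) (cong (λ t → [ p ] , [ q ] , t) (sym eq))
                         (adj-move Z e (β (p , q , r)))
    from : ∀ x y → Adj Λ₃ (β x) (β y) → Adj Q₃ x y
    from (p , q , r) (p' , q' , r') adj with adj⇒move (β (p , q , r)) (β (p' , q' , r')) adj
    ... | X , e , eq with []-injective (cong (proj₁ ∘ proj₂) eq) | []-injective (cong (proj₂ ∘ proj₂) eq)
    ...   | refl | refl = inj₁ ((λ { refl → unit-moves-bit p e (cong proj₁ eq) }) , refl)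
    from (p , q , r) (p' , q' , r') adj | Y , e , eq
      with []-injective (cong proj₁ eq) | []-injective (cong (proj₂ ∘ proj₂) eq)
    ...   | refl | refl =
      inj₂ (refl , inj₁ ((λ { refl → unit-moves-bit q e (cong (proj₁ ∘ proj₂) eq) }) , refl))
    from (p , q , r) (p' , q' , r') adj | Z , e , eq
      with []-injective (cong proj₁ eq) | []-injective (cong (proj₁ ∘ proj₂) eq)
    ...   | refl | refl =
      inj₂ (refl , inj₂ (refl , λ { refl → unit-moves-bit r e (cong (proj₂ ∘ proj₂) eq) }))

cube-adjacency : ∀ A x y → Adj Q₃ x y ⇔ Adj Λ₃ (cube A x) (cube A y)
cube-adjacency A x y = subst (Adj Q₃ x y ⇔_) (sym (adj-translate A (β x) (β y))) (β-adjacency x y)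

cube-injective : ∀ A → Injective _≡_ _≡_ (cube A)
cube-injective (a , b , c) {p , q , r} {p' , q' , r'} eq
  with []-injective (∙-cancelˡ a _ _ (cong proj₁ eq))
     | []-injective (∙-cancelˡ b _ _ (cong (proj₁ ∘ proj₂) eq))
     | []-injective (∙-cancelˡ c _ _ (cong (proj₂ ∘ proj₂) eq))
... | refl | refl | refl = refl

Reach : (G : Graph) → V G → V G → Set
Reach G u v = u ≡ v ⊎ Adj G u v

P₂-reach : ∀ p q → Reach P₂ p q
P₂-reach p q with p ≟ᵇ q
... | yes p≡q = inj₁ p≡q
... | no  p≢q = inj₂ p≢q

□-reachˡ : ∀ {G H g g' h} → Reach G g g' → Reach (G □ H) (g , h) (g' , h)
□-reachˡ (inj₁ refl) = inj₁ refl
□-reachˡ (inj₂ adj)  = inj₂ (inj₁ (adj , refl))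

□-reachʳ : ∀ {G H g h h'} → Reach H h h' → Reach (G □ H) (g , h) (g , h')
□-reachʳ (inj₁ refl) = inj₁ refl
□-reachʳ (inj₂ adj)  = inj₂ (inj₂ (refl , adj))

IsCubeComponent : Pred ℤ³ 0ℓ → ℤ³ → Set
IsCubeComponent S A =
  (∀ x → S (cube A x)) × (∀ x w → S w → Adj Λ₃ (cube A x) w → ∃ λ x' → w ≡ cube A x')

module _ {S : Pred ℤ³ 0ℓ} {A : ℤ³} where

  cube-connected : (∀ x → S (cube A x)) → ∀ x y → Conn S (cube A x) (cube A y)
  cube-connected inS (p , q , r) (p' , q' , r') =
    Conn-trans (edge (□-reachˡ {P₂} {P₂ □ P₂} (P₂-reach p p')))
   (Conn-trans (edge (□-reachʳ {P₂} {P₂ □ P₂} (□-reachˡ {P₂} {P₂} (P₂-reach q q'))))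
               (edge (□-reachʳ {P₂} {P₂ □ P₂} (□-reachʳ {P₂} {P₂} (P₂-reach r r')))))
    where
      edge : ∀ {x y} → Reach Q₃ x y → Conn S (cube A x) (cube A y)
      edge (inj₁ refl) = Conn-refl (inS _)
      edge (inj₂ adj)  = Conn-edge (inS _) (inS _) (Equivalence.to (cube-adjacency A _ _) adj)

  walk-in-cube : (∀ x w → S w → Adj Λ₃ (cube A x) w → ∃ λ x' → w ≡ cube A x') →
                 ∀ {x w n} → WalkIn S (cube A x) w n → ∃ λ x' → w ≡ cube A x'
  walk-in-cube closed {x} (here _) = x , refl
  walk-in-cube closed {x} (step _ adj walk) with closed x _ (walk-start walk) adj
  ... | x' , refl = walk-in-cube closed walk

cubes⇒componentsIso : ∀ {S} → (∀ s → S s → ∃₂ λ A x → IsCubeComponent S A × s ≡ cube A x) →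
                      ComponentsIso Q₃ S
cubes⇒componentsIso {S} cubes s Ss with cubes s Ss
... | A , x₀ , (inS , closed) , refl =
  cube A , cube-injective A , cube-connected {A = A} inS x₀ , covered , cube-adjacency A
  where
    covered : ∀ y → Conn S (cube A x₀) y → ∃ λ x → cube A x ≡ y
    covered y (_ , walk) with walk-in-cube {A = A} closed walk
    ... | x , eq = x , sym eq

-- Coordinates modulo 4, in binary as (high bit , low bit)

Digit : Set
Digit = Bool × Bool

inc dec : Digit → Digit
inc (h , false) = h , true
inc (h , true)  = not h , false
dec (h , true)  = h , false
dec (h , false) = not h , true

mod4 : ℤ → Digit
mod4 (+ zero)     = false , false
mod4 (+ suc n)    = inc (mod4 (+ n))
mod4 -[1+ zero ]  = true , true
mod4 -[1+ suc n ] = dec (mod4 -[1+ n ])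

hi lo : ℤ → Bool
hi a = proj₁ (mod4 a)
lo a = proj₂ (mod4 a)

mod4-inc : ∀ a → mod4 (a + + 1) ≡ inc (mod4 a)
mod4-inc (+ n) rewrite +-comm n 1 = refl
mod4-inc -[1+ zero ]  = refl
mod4-inc -[1+ suc n ] with mod4 -[1+ n ]
... | h , true  = refl
... | h , false = cong (_, false) (sym (not-involutive h))

mod4-dec : ∀ a → mod4 (a + -[1+ 0 ]) ≡ dec (mod4 a)
mod4-dec (+ zero)  = refl
mod4-dec (+ suc n) with mod4 (+ n)
... | h , false = refl
... | h , true  = cong (_, true) (sym (not-involutive h))
mod4-dec -[1+ n ] rewrite +-identityʳ n = refl

shift : Sign → Digit → Digit
shift up   = inc
shift down = dec

mod4-step : ∀ a e → mod4 (a + unit e) ≡ shift e (mod4 a)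
mod4-step a up   = mod4-inc a
mod4-step a down = mod4-dec a

-- whether a step in direction e from a digit with low bit b changes its high bit
crosses : Sign → Bool → Bool
crosses up   b = b
crosses down b = not b

exit : Bool → Sign
exit true  = up
exit false = down

crosses-exit : ∀ b → crosses (exit b) b ≡ true
crosses-exit true  = refl
crosses-exit false = refl

crosses⇒exit : ∀ {e b} → crosses e b ≡ true → e ≡ exit b
crosses⇒exit {up}   {true}  _ = refl
crosses⇒exit {down} {false} _ = refl
crosses⇒exit {up}   {false} ()
crosses⇒exit {down} {true}  ()

bit-stays : ∀ p e → crosses e p ≡ false → ∃ λ p' → [ p ] + unit e ≡ [ p' ]
bit-stays false up   _ = true , refl
bit-stays true  down _ = false , refl
bit-stays true  up   ()
bit-stays false down ()

hi-crossing : ∀ a e → crosses e (lo a) ≡ true → hi (a + unit e) ≡ not (hi a)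
hi-crossing a e cr = trans (cong proj₁ (mod4-step a e)) (crossing e (mod4 a) cr)
  where
    crossing : ∀ e d → crosses e (proj₂ d) ≡ true → proj₁ (shift e d) ≡ not (proj₁ d)
    crossing up   (_ , true)  _ = refl
    crossing down (_ , false) _ = refl
    crossing up   (_ , false) ()
    crossing down (_ , true)  ()

hi-inside : ∀ a e → crosses e (lo a) ≡ false → hi (a + unit e) ≡ hi a
hi-inside a e cr = trans (cong proj₁ (mod4-step a e)) (inside e (mod4 a) cr)
  where
    inside : ∀ e d → crosses e (proj₂ d) ≡ false → proj₁ (shift e d) ≡ proj₁ d
    inside up   (_ , false) _ = refl
    inside down (_ , true)  _ = refl
    inside up   (_ , true)  ()
    inside down (_ , false) ()

his : ℤ³ → B³
his (a , b , c) = hi a , hi b , hi c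

Constant : B³ → Set
Constant (p , q , r) = p ≡ q × q ≡ r

constant? : ∀ h → Dec (Constant h)
constant? (p , q , r) = (p ≟ᵇ q) ×-dec (q ≟ᵇ r)

cubeLattice : Pred ℤ³ 0ℓ
cubeLattice v = Constant (his v)

flip : Axis → B³ → B³
flip X (p , q , r) = not p , q , r
flip Y (p , q , r) = p , not q , r
flip Z (p , q , r) = p , q , not r

-- the coordinate that differs from the other two (X, as a junk value, on constant triples)
odd : B³ → Axis
odd (false , true  , true)  = X
odd (true  , false , false) = X
odd (false , true  , false) = Y
odd (true  , false , true)  = Y
odd (false , false , true)  = Z
odd (true  , true  , false) = Z
odd (false , false , false) = X
odd (true  , true  , true)  = X

odd-flip-constant : ∀ h → ¬ Constant h → Constant (flip (odd h) h)
odd-flip-constant (false , true  , true)  _ = refl , refl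
odd-flip-constant (true  , false , false) _ = refl , refl
odd-flip-constant (false , true  , false) _ = refl , refl
odd-flip-constant (true  , false , true)  _ = refl , refl
odd-flip-constant (false , false , true)  _ = refl , refl
odd-flip-constant (true  , true  , false) _ = refl , refl
odd-flip-constant (false , false , false) nc = ⊥-elim (nc (refl , refl))
odd-flip-constant (true  , true  , true)  nc = ⊥-elim (nc (refl , refl))

flip-constant⇒odd : ∀ i h → Constant (flip i h) → i ≡ odd h
flip-constant⇒odd X (false , _ , _) (refl , refl) = refl
flip-constant⇒odd X (true  , _ , _) (refl , refl) = refl
flip-constant⇒odd Y (_ , false , _) (refl , refl) = refl
flip-constant⇒odd Y (_ , true  , _) (refl , refl) = refl
flip-constant⇒odd Z (_ , _ , false) (refl , refl) = refl
flip-constant⇒odd Z (_ , _ , true)  (refl , refl) = refl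

his-crossing : ∀ i e v → crosses e (lo (coord i v)) ≡ true → his (move i e v) ≡ flip i (his v)
his-crossing X e (a , b , c) cr = cong (_, hi b , hi c) (hi-crossing a e cr)
his-crossing Y e (a , b , c) cr = cong (λ t → hi a , t , hi c) (hi-crossing b e cr)
his-crossing Z e (a , b , c) cr = cong (λ t → hi a , hi b , t) (hi-crossing c e cr)

his-inside : ∀ i e v → crosses e (lo (coord i v)) ≡ false → his (move i e v) ≡ his v
his-inside X e (a , b , c) cr = cong (_, hi b , hi c) (hi-inside a e cr)
his-inside Y e (a , b , c) cr = cong (λ t → hi a , t , hi c) (hi-inside b e cr)
his-inside Z e (a , b , c) cr = cong (λ t → hi a , hi b , t) (hi-inside c e cr)

cubeLattice-perfectDominating : PerfectDominating cubeLattice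
cubeLattice-perfectDominating v with constant? (his v)
... | yes c  = inj₁ c
... | no  nc = inj₂ (nc , move i e v , reached , adj-move i e v , unique)
  where
    i = odd (his v)
    e = exit (lo (coord i v))
    reached : cubeLattice (move i e v)
    reached = subst Constant (sym (his-crossing i e v (crosses-exit (lo (coord i v)))))
                             (odd-flip-constant (his v) nc)
    unique : ∀ w → cubeLattice w → Adj Λ₃ v w → w ≡ move i e v
    unique w Sw adj with adj⇒move v w adj
    ... | j , e' , refl with crosses e' (lo (coord j v)) in cr
    ...   | false = ⊥-elim (nc (subst Constant (his-inside j e' v cr) Sw))
    ...   | true with flip-constant⇒odd j (his v) (subst Constant (his-crossing j e' v cr) Sw)
    ...     | refl = cong (λ s → move j s v) (crosses⇒exit cr)

Low : Bool → ℤ → Set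
Low H a = mod4 a ≡ (H , false)

Corner : Bool → ℤ³ → Set
Corner H (a , b , c) = Low H a × Low H b × Low H c

clear-lo : ∀ a {h b} → mod4 a ≡ (h , b) → Low h (a - [ b ])
clear-lo a {b = false} eq = trans (cong mod4 (ℤᵖ.+-identityʳ a)) eq
clear-lo a {b = true}  eq = trans (mod4-dec a) (cong dec eq)

low+bit : ∀ {H} a → Low H a → ∀ p → mod4 (a + [ p ]) ≡ (H , p)
low+bit a l false = trans (cong mod4 (ℤᵖ.+-identityʳ a)) l
low+bit a l true  = trans (mod4-inc a) (cong inc l)

low-step : ∀ {H} a → Low H a → ∀ p e →
           (∃ λ p' → a + [ p ] + unit e ≡ a + [ p' ]) ⊎ hi (a + [ p ] + unit e) ≡ not H
low-step {H} a l p e with crosses e p in cr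
... | true  = inj₂ (trans (hi-crossing (a + [ p ]) e (trans (cong (crosses e) lo≡p) cr))
                          (cong not (cong proj₁ (low+bit a l p))))
  where lo≡p = cong proj₂ (low+bit a l p)
... | false with bit-stays p e cr
...   | p' , eq = inj₁ (p' , trans (ℤᵖ.+-assoc a [ p ] (unit e)) (cong (_+_ a) eq))

corner-component : ∀ {H A} → Corner H A → IsCubeComponent cubeLattice A
corner-component {H} {a , b , c} (la , lb , lc) = inS , closed
  where
    hi-a : ∀ p → hi (a + [ p ]) ≡ H
    hi-a p = cong proj₁ (low+bit a la p)
    hi-b : ∀ q → hi (b + [ q ]) ≡ H
    hi-b q = cong proj₁ (low+bit b lb q)
    hi-c : ∀ r → hi (c + [ r ]) ≡ H
    hi-c r = cong proj₁ (low+bit c lc r)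
    not-H : ¬ not H ≡ H
    not-H eq = not-¬ refl (sym eq)
    inS : ∀ x → cubeLattice (cube (a , b , c) x)
    inS (p , q , r) = trans (hi-a p) (sym (hi-b q)) , trans (hi-b q) (sym (hi-c r))
    closed : ∀ x w → cubeLattice w → Adj Λ₃ (cube (a , b , c) x) w → ∃ λ x' → w ≡ cube (a , b , c) x'
    closed (p , q , r) w Sw adj with adj⇒move (cube (a , b , c) (p , q , r)) w adj
    ... | X , e , refl with low-step a la p e
    ...   | inj₁ (p' , eq) = (p' , q , r) , cong (_, _) eq
    ...   | inj₂ flipped   = ⊥-elim (not-H (trans (sym flipped) (trans (proj₁ Sw) (hi-b q))))
    closed (p , q , r) w Sw adj | Y , e , refl with low-step b lb q e
    ...   | inj₁ (q' , eq) = (p , q' , r) , cong (λ t → _ , t , _) eq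
    ...   | inj₂ flipped   = ⊥-elim (not-H (trans (sym flipped) (trans (proj₂ Sw) (hi-c r))))
    closed (p , q , r) w Sw adj | Z , e , refl with low-step c lc r e
    ...   | inj₁ (r' , eq) = (p , q , r') , cong (λ t → _ , _ , t) eq
    ...   | inj₂ flipped   = ⊥-elim (not-H (trans (sym flipped) (trans (sym (proj₂ Sw)) (hi-b q))))

cubeLattice-cubes : ∀ s → cubeLattice s → ∃₂ λ A x → IsCubeComponent cubeLattice A × s ≡ cube A x
cubeLattice-cubes (a , b , c) (ab , bc) =
  A , (lo a , lo b , lo c) , corner-component {A = A} corner ,
  cong₂ _,_ (a-p+p a _) (cong₂ _,_ (a-p+p b _) (a-p+p c _))
  where
    A : ℤ³
    A = a - [ lo a ] , b - [ lo b ] , c - [ lo c ]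
    corner : Corner (hi a) A
    corner = clear-lo a refl
           , subst (λ H → Low H (b - [ lo b ])) (sym ab) (clear-lo b refl)
           , subst (λ H → Low H (c - [ lo c ])) (sym (trans ab bc)) (clear-lo c refl)
    a-p+p : ∀ a p → a ≡ a - p + p
    a-p+p = solve-∀

theorem4 : Σ (Pred ℤ³ 0ℓ) (λ S → IsPDDS[ Q₃ ] 1 S)
theorem4 = cubeLattice
         , perfectDominating⇒PDDS cubeLattice-perfectDominating
         , cubes⇒componentsIso cubeLattice-cubes
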